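{- Let $n\ge 1$ and let $w$ be a bijection $w:\mathbb{Z}\to\mathbb{Z}$ with $w(x+2n)=w(x)+2n$ for all $x\in\mathbb{Z}$, $\sum_{i=1}^{2n}w(i)=\binom{2n+1}{2}$, and $w(1)<w(2)<\cdots<w(2n)$ (i.e. $w\mathcal{A}_0$ is a dominant alcove of the Shi arrangement of type $A_{2n-1}$). Then the level vector of $w$ is antisymmetric, i.e. of the form $(\beta_1,\ldots,\beta_n,-\beta_n,\ldots,-\beta_1)$, if and only if the abacus diagram of $w$ is balanced.
   Context: Base-level notation with respect to $N=2n$: every integer $a$ is written $a=r^{\ell}$, meaning $a=r+2n\ell$ with base $r\in\{1,\ldots,2n\}$ and level $\ell\in\mathbb{Z}$. The abacus diagram of $w$ is its base window $[w(1),\ldots,w(2n)]$ written in base-level notation as $[r_1^{\ell_1},\ldots,r_{2n}^{\ell_{2n}}]$; necessarily $\{r_1,\ldots,r_{2n}\}=\{1,\ldots,2n\}$ and $\ell_1+\cdots+\ell_{2n}=0$. The level vector of $w$ is $(\beta_1,\ldots,\beta_{2n})$, where $\beta_i$ is the level of the unique entry of the base window with base $i$. The abacus is called balanced if it has the form $[r_1^{\ell_1},\ldots,r_n^{\ell_n},r_{n+1}^{ -\ell_n},\ldots,r_{2n}^{ -\ell_1}]$ with $r_i+r_{2n+1-i}=2n+1$ for all $1\le i\le n$. -}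

module Defs where

open import Data.Nat as ℕ using (ℕ; zero; suc; NonZero)
open import Data.Nat.Properties using (m*n≢0)
open import Data.Integer as ℤ using (ℤ; +_; _+_; _-_; _*_; -_; _/ℕ_; _%ℕ_; 0ℤ; 1ℤ)
open import Data.List using (List; []; _∷_; foldr; applyUpTo)
open import Relation.Nullary using (yes; no)

twoN : ℕ → ℕ
twoN n = 2 ℕ.* n

-- Base-level notation w.r.t. N = 2n:  a = r + 2n·ℓ  with r ∈ {1,…,2n}, ℓ ∈ ℤ.
-- r - 1 = (a - 1) mod 2n and ℓ = (a - 1) div 2n (floor division).
base : (n : ℕ) .{{_ : NonZero n}} → ℤ → ℕ
base n a = suc ((a - 1ℤ) %ℕ twoN n)
  where instance _ = m*n≢0 2 n

level : (n : ℕ) .{{_ : NonZero n}} → ℤ → ℤ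
level n a = (a - 1ℤ) /ℕ twoN n
  where instance _ = m*n≢0 2 n

sumℤ : List ℤ → ℤ
sumℤ = foldr _+_ 0ℤ

baseWindow : (n : ℕ) → (ℤ → ℤ) → List ℤ
baseWindow n w = applyUpTo (λ j → w (+ suc j)) (twoN n)

-- level of the first entry in a list whose base is i (0 if none; for a
-- window of an affine permutation exactly one entry has base i)
levelOfBaseIn : (n : ℕ) .{{_ : NonZero n}} → ℕ → List ℤ → ℤ
levelOfBaseIn n i [] = 0ℤ
levelOfBaseIn n i (a ∷ as) with base n a ℕ.≟ i
... | yes _ = level n a
... | no  _ = levelOfBaseIn n i as

levelVector : (n : ℕ) .{{_ : NonZero n}} → (ℤ → ℤ) → ℕ → ℤ
levelVector n w i = levelOfBaseIn n i (baseWindow n w)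

AntisymmetricLevelVector : (n : ℕ) .{{_ : NonZero n}} → (ℤ → ℤ) → Set
AntisymmetricLevelVector n w =
  ∀ i → 1 ℕ.≤ i → i ℕ.≤ n →
    levelVector n w (suc (twoN n) ℕ.∸ i) ≡ - levelVector n w i
  where open import Relation.Binary.PropositionalEquality using (_≡_)

-- The abacus [r₁^{ℓ₁},…,r₂ₙ^{ℓ₂ₙ}] (r_j = base (w j), ℓ_j = level (w j)) is
-- balanced: for 1 ≤ i ≤ n, r_i + r_{2n+1-i} = 2n+1 and ℓ_{2n+1-i} = -ℓ_i.
BalancedAbacus : (n : ℕ) .{{_ : NonZero n}} → (ℤ → ℤ) → Set
BalancedAbacus n w =
  ∀ i → 1 ℕ.≤ i → i ℕ.≤ n →
    (base n (w (+ i)) ℕ.+ base n (w (+ (suc (twoN n) ℕ.∸ i))) ≡ suc (twoN n))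
    × (level n (w (+ (suc (twoN n) ℕ.∸ i))) ≡ - level n (w (+ i)))
  where open import Relation.Binary.PropositionalEquality using (_≡_)
        open import Data.Product using (_×_)

-- Write ρ a = 2n+1 − a.  Then base (ρ a) = 2n+1 − base a and level (ρ a) = − level a, so the
-- level vector is antisymmetric exactly when ρ maps the set of window entries {w(1),…,w(2n)} to
-- itself, and the abacus is balanced exactly when w(2n+1−i) = ρ (w i) for every i.  The second
-- property clearly implies the first.  Conversely, if ρ permutes the window entries, it induces a
-- self-map of {1,…,2n} which is strictly decreasing because the window is increasing; the only such
-- map is i ↦ 2n+1−i.
module Submission where

open import Defs
open import Data.Nat.Combinatorics using (_C_)
open import Data.Nat as ℕ using (ℕ; zero; suc; NonZero; _≤_; _<_; z≤n; s≤s; _≤?_; _∸_)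
open import Data.Nat.Properties
  using ( ≤-refl; ≤-trans; ≤-reflexive; ≤-antisym; <⇒≤; <⇒≱; ≰⇒>; m≤m+n; +-mono-≤; +-monoˡ-≤; +-comm
        ; +-suc; +-identityʳ; m+n∸n≡m; m+n∸m≡n; m+[n∸m]≡n; m∸[m∸n]≡n; m∸n≤m; m<n⇒0<n∸m
        ; ∸-monoʳ-≤; m≤n⇒m≤1+n; m≤n⇒m<n∨m≡n; <-cmp; m*n≢0; module ≤-Reasoning)
open import Data.Integer as ℤ using (ℤ; +_; +[1+_]; -[1+_]; _+_; _-_; _*_; -_; _%ℕ_; _/ℕ_; 0ℤ; 1ℤ)
import Data.Integer.Properties as ℤ
open import Data.Integer.DivMod using (a≡a%ℕn+[a/ℕn]*n; n%ℕd<d)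
open import Data.Integer.Tactic.RingSolver using (solve-∀)
open import Data.List using (_∷_)
open import Data.List.Membership.Propositional using (_∈_)
open import Data.List.Membership.Propositional.Properties using (∈-applyUpTo⁺; ∈-applyUpTo⁻)
open import Data.List.Relation.Unary.Any using (here; there)
open import Data.Product using (∃-syntax; _×_; _,_; proj₁; proj₂)
open import Data.Empty using (⊥-elim)
open import Data.Sum using (inj₁; inj₂)
open import Function.Base using (_∘_)
open import Function.Bundles using (_⇔_; mk⇔)
open import Function.Definitions using (Bijective)
open import Relation.Binary.Definitions using (Symmetric; tri<; tri≈; tri>)
open import Relation.Binary.PropositionalEquality
open import Relation.Nullary using (yes; no; contradiction)

move-multiple : ∀ (x y K P : ℤ) → x ≡ y + K * P → y ≡ x + (- K) * P
move-multiple x y K P refl = shifted y K P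
  where
  shifted : ∀ (y K P : ℤ) → y ≡ (y + K * P) + (- K) * P
  shifted = solve-∀

+r≡+s+d*N⇒r≡s×d≡0 : ∀ {N r s} d → 1 ≤ r → r ≤ N → 1 ≤ s → s ≤ N →
                      + r ≡ + s + d * + N → r ≡ s × d ≡ 0ℤ
+r≡+s+d*N⇒r≡s×d≡0 {s = s} (+ zero) _ _ _ _ eq =
  ℤ.+-injective (trans eq (ℤ.+-identityʳ (+ s))) , refl
+r≡+s+d*N⇒r≡s×d≡0 {N} {r} {s} +[1+ k ] _ r≤N 1≤s _ eq =
  contradiction r≤N (<⇒≱ (subst (N <_) (sym r≡s+[1+k]N) (+-mono-≤ 1≤s (m≤m+n N (k ℕ.* N)))))
  where
  r≡s+[1+k]N : r ≡ s ℕ.+ suc k ℕ.* N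
  r≡s+[1+k]N = ℤ.+-injective (trans eq (cong (_+_ (+ s)) (sym (ℤ.pos-* (suc k) N))))
+r≡+s+d*N⇒r≡s×d≡0 {N} {r} {s} -[1+ k ] 1≤r _ _ s≤N eq =
  contradiction s≤N (<⇒≱ (subst (N <_) (sym s≡r+[1+k]N) (+-mono-≤ 1≤r (m≤m+n N (k ℕ.* N)))))
  where
  s≡r+[1+k]N : s ≡ r ℕ.+ suc k ℕ.* N
  s≡r+[1+k]N = ℤ.+-injective (trans (move-multiple (+ r) (+ s) -[1+ k ] (+ N) eq)
                                    (cong (_+_ (+ r)) (sym (ℤ.pos-* (suc k) N))))

module _ {N : ℕ} (g : ℕ → ℤ) (step : ∀ p → 1 ≤ p → suc p ≤ N → g p ℤ.< g (suc p)) where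

  consecutive<⇒< : ∀ {a b} → 1 ≤ a → a < b → b ≤ N → g a ℤ.< g b
  consecutive<⇒< {a} {suc b} 1≤a (s≤s a≤b) b<N with m≤n⇒m<n∨m≡n a≤b
  ... | inj₂ refl = step a 1≤a b<N
  ... | inj₁ a<b  = ℤ.<-trans (consecutive<⇒< 1≤a a<b (<⇒≤ b<N))
                              (step b (≤-trans 1≤a (<⇒≤ a<b)) b<N)

  consecutive<⇒<-reflect : ∀ {a b} → 1 ≤ b → a ≤ N → g a ℤ.< g b → a < b
  consecutive<⇒<-reflect {a} {b} 1≤b a≤N ga<gb with <-cmp a b
  ... | tri< a<b _ _ = a<b
  ... | tri≈ _ refl _ = ⊥-elim (ℤ.<-irrefl refl ga<gb)
  ... | tri> _ _ b<a = ⊥-elim (ℤ.<-asym ga<gb (consecutive<⇒< 1≤b b<a a≤N))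

module _ {N : ℕ} (f : ℕ → ℕ) (bounds : ∀ p → 1 ≤ p → p ≤ N → 1 ≤ f p × f p ≤ N)
         (step : ∀ p → 1 ≤ p → suc p ≤ N → f (suc p) < f p) where

  private
    upper : ∀ p → 1 ≤ p → p ≤ N → f p ℕ.+ p ≤ suc N
    upper (suc zero) _ 1≤N = subst (_≤ suc N) (+-comm 1 (f 1)) (s≤s (proj₂ (bounds 1 ≤-refl 1≤N)))
    upper (suc (suc p)) _ p+2≤N = begin
      f (2 ℕ.+ p) ℕ.+ suc (suc p)    ≡⟨ +-suc (f (2 ℕ.+ p)) (suc p) ⟩
      suc (f (2 ℕ.+ p)) ℕ.+ suc p    ≤⟨ +-monoˡ-≤ (suc p) (step (suc p) (s≤s z≤n) p+2≤N) ⟩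
      f (suc p) ℕ.+ suc p            ≤⟨ upper (suc p) (s≤s z≤n) (<⇒≤ p+2≤N) ⟩
      suc N                          ∎
      where open ≤-Reasoning

    lower : ∀ d p → 1 ≤ p → p ℕ.+ d ≡ N → suc N ≤ f p ℕ.+ p
    lower zero p 1≤p p+0≡N =
      subst (λ m → suc m ≤ f p ℕ.+ p) p≡N (+-monoˡ-≤ p (proj₁ (bounds p 1≤p (≤-reflexive p≡N))))
      where
      p≡N : p ≡ N
      p≡N = trans (sym (+-identityʳ p)) p+0≡N
    lower (suc d) p 1≤p p+d+1≡N = begin
      suc N                  ≤⟨ lower d (suc p) (s≤s z≤n) p+1+d≡N ⟩
      f (suc p) ℕ.+ suc p    ≡⟨ +-suc (f (suc p)) p ⟩
      suc (f (suc p)) ℕ.+ p  ≤⟨ +-monoˡ-≤ p (step p 1≤p (≤-trans (m≤m+n (suc p) d)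
                                                                 (≤-reflexive p+1+d≡N))) ⟩
      f p ℕ.+ p              ∎
      where
      open ≤-Reasoning
      p+1+d≡N : suc p ℕ.+ d ≡ N
      p+1+d≡N = trans (sym (+-suc p d)) p+d+1≡N

  decreasing⇒reverse : ∀ p → 1 ≤ p → p ≤ N → f p ≡ suc N ∸ p
  decreasing⇒reverse p 1≤p p≤N =
    trans (sym (m+n∸n≡m (f p) p))
          (cong (_∸ p) (≤-antisym (upper p 1≤p p≤N) (lower (N ∸ p) p 1≤p (m+[n∸m]≡n p≤N))))

module Mirror (n : ℕ) where

  opposite : ℕ → ℕ
  opposite i = suc (twoN n) ∸ i

  opposite-bounds : ∀ {i} → 1 ≤ i → i ≤ twoN n → 1 ≤ opposite i × opposite i ≤ twoN n
  opposite-bounds {suc i} _ i<2n = m<n⇒0<n∸m (s≤s i<2n) , m∸n≤m (twoN n) i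

  opposite-involutive : ∀ {i} → i ≤ twoN n → opposite (opposite i) ≡ i
  opposite-involutive i≤2n = m∸[m∸n]≡n (m≤n⇒m≤1+n i≤2n)

  opposite-≤ : ∀ {i} → n < i → opposite i ≤ n
  opposite-≤ {suc i} (s≤s n≤i) = subst (twoN n ∸ i ≤_) 2n∸n≡n (∸-monoʳ-≤ (twoN n) n≤i)
    where
    2n∸n≡n : twoN n ∸ n ≡ n
    2n∸n≡n = trans (m+n∸m≡n n (n ℕ.+ 0)) (+-identityʳ n)

  ≤n⇒≤2n : ∀ {i} → i ≤ n → i ≤ twoN n
  ≤n⇒≤2n i≤n = ≤-trans i≤n (m≤m+n n (n ℕ.+ 0))

  opposite-+ : ∀ {i j} → i ℕ.+ j ≡ suc (twoN n) → j ≡ opposite i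
  opposite-+ {i} {j} i+j≡ = trans (sym (m+n∸m≡n i j)) (cong (_∸ i) i+j≡)

  extend-mirrored : ∀ {ℓ} (R : ℕ → ℕ → Set ℓ) → Symmetric R →
                    (∀ i → 1 ≤ i → i ≤ n → R i (opposite i)) →
                    ∀ i → 1 ≤ i → i ≤ twoN n → R i (opposite i)
  extend-mirrored R sym-R half i 1≤i i≤2n with i ≤? n
  ... | yes i≤n = half i 1≤i i≤n
  ... | no  i≰n = sym-R (subst (R (opposite i)) (opposite-involutive i≤2n)
                               (half (opposite i) (proj₁ (opposite-bounds 1≤i i≤2n)) (opposite-≤ (≰⇒> i≰n))))

periodic-shift : ∀ (w : ℤ → ℤ) P → (∀ x → w (x + P) ≡ w x + P) → ∀ x k → w (x + k * P) ≡ w x + k * P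
periodic-shift w P per = shift
  where
  open ≡-Reasoning

  no-shift : ∀ x → x + + 0 * P ≡ x
  no-shift x = trans (cong (_+_ x) (ℤ.*-zeroˡ P)) (ℤ.+-identityʳ x)

  shift-suc : ∀ (x M P : ℤ) → x + (1ℤ + M) * P ≡ (x + M * P) + P
  shift-suc = solve-∀

  shiftℕ : ∀ x m → w (x + + m * P) ≡ w x + + m * P
  shiftℕ x zero = trans (cong w (no-shift x)) (sym (no-shift (w x)))
  shiftℕ x (suc m) = begin
    w (x + + suc m * P)        ≡⟨ cong w (shift-suc x (+ m) P) ⟩
    w ((x + + m * P) + P)      ≡⟨ per _ ⟩
    w (x + + m * P) + P        ≡⟨ cong (_+ P) (shiftℕ x m) ⟩
    (w x + + m * P) + P        ≡⟨ sym (shift-suc (w x) (+ m) P) ⟩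
    w x + + suc m * P          ∎

  undo : ∀ (x K P : ℤ) → (x + (- K) * P) + K * P ≡ x
  undo = solve-∀

  shift : ∀ x k → w (x + k * P) ≡ w x + k * P
  shift x (+ m) = shiftℕ x m
  shift x -[1+ m ] = move-multiple (w x) (w y) (+ suc m) P
    (trans (cong w (sym (undo x (+ suc m) P))) (shiftℕ y (suc m)))
    where y = x + -[1+ m ] * P

module BaseLevel (n : ℕ) .{{_ : NonZero n}} where
  open Mirror n

  N : ℕ
  N = twoN n

  instance
    N≢0 : NonZero N
    N≢0 = m*n≢0 2 n

  1≤base : ∀ a → 1 ≤ base n a
  1≤base a = s≤s z≤n

  base≤N : ∀ a → base n a ≤ N
  base≤N a = n%ℕd<d (a - 1ℤ) N

  base-level-decomposition : ∀ a → a ≡ + base n a + level n a * + N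
  base-level-decomposition a = begin
    a                                                    ≡⟨ shift-one a ⟩
    1ℤ + (a - 1ℤ)                                        ≡⟨ cong (_+_ 1ℤ) (a≡a%ℕn+[a/ℕn]*n (a - 1ℤ) N) ⟩
    1ℤ + (+ r + q * + N)                                 ≡⟨ sym (ℤ.+-assoc 1ℤ (+ r) (q * + N)) ⟩
    + base n a + level n a * + N                         ∎
    where
    open ≡-Reasoning
    r = (a - 1ℤ) %ℕ N
    q = (a - 1ℤ) /ℕ N
    shift-one : ∀ a → a ≡ 1ℤ + (a - 1ℤ)
    shift-one = solve-∀

  base-level-unique : ∀ {a r ℓ} → 1 ≤ r → r ≤ N → a ≡ + r + ℓ * + N → base n a ≡ r × level n a ≡ ℓ
  base-level-unique {a} {r} {ℓ} 1≤r r≤N a≡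
    with +r≡+s+d*N⇒r≡s×d≡0 (ℓ - level n a) (1≤base a) (base≤N a) 1≤r r≤N base≡
    where
    B = + base n a
    L = level n a
    regroup : ∀ (r ℓ L N : ℤ) → (r + ℓ * N) + (- L) * N ≡ r + (ℓ - L) * N
    regroup = solve-∀
    base≡ : B ≡ + r + (ℓ - L) * + N
    base≡ = begin
      B                                ≡⟨ move-multiple (B + L * + N) B L (+ N) refl ⟩
      (B + L * + N) + (- L) * + N      ≡⟨ cong (_+ (- L) * + N) (trans (sym (base-level-decomposition a)) a≡) ⟩
      (+ r + ℓ * + N) + (- L) * + N    ≡⟨ regroup (+ r) ℓ L (+ N) ⟩
      + r + (ℓ - L) * + N              ∎
      where open ≡-Reasoning
  ... | base≡r , d≡0 = base≡r , sym (ℤ.i-j≡0⇒i≡j ℓ (level n a) d≡0)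

  base-level-injective : ∀ {a b} → base n a ≡ base n b → level n a ≡ level n b → a ≡ b
  base-level-injective {a} {b} base≡ level≡ =
    trans (base-level-decomposition a)
          (trans (cong₂ (λ r ℓ → + r + ℓ * + N) base≡ level≡) (sym (base-level-decomposition b)))

  opposite-base-bounds : ∀ a → 1 ≤ opposite (base n a) × opposite (base n a) ≤ N
  opposite-base-bounds a = opposite-bounds (1≤base a) (base≤N a)

  reflect : ℤ → ℤ
  reflect a = + suc N - a

  reflect-< : ∀ {a b} → a ℤ.< b → reflect b ℤ.< reflect a
  reflect-< a<b = ℤ.+-monoʳ-< (+ suc N) (ℤ.neg-mono-< a<b)

  base-level-reflect : ∀ a → base n (reflect a) ≡ opposite (base n a) × level n (reflect a) ≡ - level n a
  base-level-reflect a =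
    base-level-unique (proj₁ (opposite-base-bounds a)) (proj₂ (opposite-base-bounds a)) reflect-decomposition
    where
    r = base n a
    rearrange : ∀ (r r' ℓ N : ℤ) → (r + r') - (r + ℓ * N) ≡ r' + (- ℓ) * N
    rearrange = solve-∀
    reflect-decomposition : reflect a ≡ + opposite r + (- level n a) * + N
    reflect-decomposition = begin
      + suc N - a                                             ≡⟨ cong₂ _-_ (cong +_ (sym (m+[n∸m]≡n (m≤n⇒m≤1+n (base≤N a)))))
                                                                           (base-level-decomposition a) ⟩
      (+ r + + opposite r) - (+ r + level n a * + N)          ≡⟨ rearrange (+ r) (+ opposite r) (level n a) (+ N) ⟩
      + opposite r + (- level n a) * + N                      ∎
      where open ≡-Reasoning

  levelOfBaseIn-∈ : ∀ {i a} L → a ∈ L → base n a ≡ i →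
                    ∃[ b ] b ∈ L × base n b ≡ i × levelOfBaseIn n i L ≡ level n b
  levelOfBaseIn-∈ {i} (b ∷ L) a∈ base≡ with base n b ℕ.≟ i
  ... | yes b-base = b , here refl , b-base , refl
  ... | no ¬b-base with a∈
  ...   | here refl = ⊥-elim (¬b-base base≡)
  ...   | there a∈L with levelOfBaseIn-∈ L a∈L base≡
  ...     | c , c∈L , c-base , level≡ = c , there c∈L , c-base , level≡

module AffinePermutation (n : ℕ) .{{_ : NonZero n}} (w : ℤ → ℤ) (w-bijective : Bijective _≡_ _≡_ w)
         (w-periodic : ∀ x → w (x + + twoN n) ≡ w x + + twoN n)
         (window-increasing : ∀ i → 1 ≤ i → suc i ≤ twoN n → w (+ i) ℤ.< w (+ suc i)) where
  open Mirror n
  open BaseLevel n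

  w-shift : ∀ x k → w (x + k * + N) ≡ w x + k * + N
  w-shift = periodic-shift w (+ N) w-periodic

  w-injective : ∀ {x y} → w x ≡ w y → x ≡ y
  w-injective = proj₁ w-bijective

  w⁻¹ : ℤ → ℤ
  w⁻¹ y = proj₁ (proj₂ w-bijective y)

  w∘w⁻¹ : ∀ y → w (w⁻¹ y) ≡ y
  w∘w⁻¹ y = proj₂ (proj₂ w-bijective y) refl

  window-base-injective : ∀ {j k} → 1 ≤ j → j ≤ N → 1 ≤ k → k ≤ N →
                          base n (w (+ j)) ≡ base n (w (+ k)) → j ≡ k
  window-base-injective {j} {k} 1≤j j≤N 1≤k k≤N base≡ =
    proj₁ (+r≡+s+d*N⇒r≡s×d≡0 (ℓj - ℓk) 1≤j j≤N 1≤k k≤N (w-injective (sym w[k+dN]≡w[j])))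
    where
    ℓj = level n (w (+ j))
    ℓk = level n (w (+ k))
    regroup : ∀ (b ℓ ℓ′ N : ℤ) → (b + ℓ′ * N) + (ℓ - ℓ′) * N ≡ b + ℓ * N
    regroup = solve-∀
    w[k+dN]≡w[j] : w (+ k + (ℓj - ℓk) * + N) ≡ w (+ j)
    w[k+dN]≡w[j] = begin
      w (+ k + (ℓj - ℓk) * + N)                              ≡⟨ w-shift (+ k) (ℓj - ℓk) ⟩
      w (+ k) + (ℓj - ℓk) * + N                              ≡⟨ cong (_+ (ℓj - ℓk) * + N) (base-level-decomposition (w (+ k))) ⟩
      (+ base n (w (+ k)) + ℓk * + N) + (ℓj - ℓk) * + N      ≡⟨ regroup (+ base n (w (+ k))) ℓj ℓk (+ N) ⟩
      + base n (w (+ k)) + ℓj * + N                          ≡⟨ cong (λ b → + b + ℓj * + N) (sym base≡) ⟩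
      + base n (w (+ j)) + ℓj * + N                          ≡⟨ sym (base-level-decomposition (w (+ j))) ⟩
      w (+ j)                                                ∎
      where open ≡-Reasoning

  windowIndex : ℕ → ℕ
  windowIndex b = base n (w⁻¹ (+ b))

  windowIndex-bounds : ∀ b → 1 ≤ windowIndex b × windowIndex b ≤ N
  windowIndex-bounds b = 1≤base (w⁻¹ (+ b)) , base≤N (w⁻¹ (+ b))

  base-windowIndex : ∀ {b} → 1 ≤ b → b ≤ N → base n (w (+ windowIndex b)) ≡ b
  base-windowIndex {b} 1≤b b≤N =
    proj₁ (base-level-unique {w (+ j)} {b} { - ℓ} 1≤b b≤N (move-multiple (+ b) (w (+ j)) ℓ (+ N) w[x]≡))
    where
    x = w⁻¹ (+ b)
    j = windowIndex b
    ℓ = level n x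
    w[x]≡ : + b ≡ w (+ j) + ℓ * + N
    w[x]≡ = trans (sym (w∘w⁻¹ (+ b)))
                  (trans (cong w (base-level-decomposition x)) (w-shift (+ j) ℓ))

  levelVector-window : ∀ {j} → 1 ≤ j → j ≤ N → levelVector n w (base n (w (+ j))) ≡ level n (w (+ j))
  levelVector-window {suc j} 1≤j j≤N
    with levelOfBaseIn-∈ (baseWindow n w) (∈-applyUpTo⁺ (λ i → w (+ suc i)) j≤N) refl
  ... | a , a∈ , a-base , level≡ with ∈-applyUpTo⁻ (λ i → w (+ suc i)) a∈
  ...   | k , k<N , refl = trans level≡ (cong (λ i → level n (w (+ i)))
                                              (window-base-injective (s≤s z≤n) k<N 1≤j j≤N a-base))

  BalancedPair : ℕ → ℕ → Set
  BalancedPair i j = base n (w (+ i)) ℕ.+ base n (w (+ j)) ≡ suc N × level n (w (+ j)) ≡ - level n (w (+ i))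

  balancedPair-sym : Symmetric BalancedPair
  balancedPair-sym {i} {j} (base-sum , level≡) =
    trans (+-comm (base n (w (+ j))) _) base-sum ,
    trans (sym (ℤ.neg-involutive _)) (cong -_ (sym level≡))

  β : ℕ → ℤ
  β = levelVector n w

  AntisymmetricPair : ℕ → ℕ → Set
  AntisymmetricPair i j = β j ≡ - β i

  antisymmetricPair-sym : Symmetric AntisymmetricPair
  antisymmetricPair-sym β-j≡ = trans (sym (ℤ.neg-involutive _)) (cong -_ (sym β-j≡))

  balanced⇒antisymmetric : BalancedAbacus n w → AntisymmetricLevelVector n w
  balanced⇒antisymmetric balanced i 1≤i i≤n = begin
    β (opposite i)                     ≡⟨ cong β (sym base-j′) ⟩
    β (base n (w (+ j′)))              ≡⟨ levelVector-window 1≤j′ j′≤N ⟩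
    level n (w (+ j′))                 ≡⟨ proj₂ pair ⟩
    - level n (w (+ j))                ≡⟨ cong -_ (sym (levelVector-window 1≤j j≤N)) ⟩
    - β (base n (w (+ j)))             ≡⟨ cong (-_ ∘ β) base-j ⟩
    - β i                              ∎
    where
    open ≡-Reasoning
    i≤N = ≤n⇒≤2n i≤n
    j = windowIndex i
    1≤j = proj₁ (windowIndex-bounds i)
    j≤N = proj₂ (windowIndex-bounds i)
    base-j = base-windowIndex 1≤i i≤N
    j′ = opposite j
    1≤j′ = proj₁ (opposite-bounds 1≤j j≤N)
    j′≤N = proj₂ (opposite-bounds 1≤j j≤N)
    pair = extend-mirrored BalancedPair balancedPair-sym balanced j 1≤j j≤N
    base-j′ : base n (w (+ j′)) ≡ opposite i
    base-j′ = opposite-+ (subst (λ b → b ℕ.+ base n (w (+ j′)) ≡ suc N) base-j (proj₁ pair))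

  module _ (antisymmetric : AntisymmetricLevelVector n w) where

    partner : ℕ → ℕ
    partner p = windowIndex (opposite (base n (w (+ p))))

    w-partner : ∀ {p} → 1 ≤ p → p ≤ N → w (+ partner p) ≡ reflect (w (+ p))
    w-partner {p} 1≤p p≤N = base-level-injective
      (trans base-partner (sym (proj₁ (base-level-reflect (w (+ p))))))
      (begin
        level n (w (+ partner p))              ≡⟨ sym (levelVector-window 1≤q q≤N) ⟩
        β (base n (w (+ partner p)))           ≡⟨ cong β base-partner ⟩
        β (opposite r)                         ≡⟨ extend-mirrored AntisymmetricPair antisymmetricPair-sym antisymmetric
                                                                  r (1≤base (w (+ p))) (base≤N (w (+ p))) ⟩
        - β r                                  ≡⟨ cong -_ (levelVector-window 1≤p p≤N) ⟩
        - level n (w (+ p))                    ≡⟨ sym (proj₂ (base-level-reflect (w (+ p)))) ⟩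
        level n (reflect (w (+ p)))            ∎)
      where
      open ≡-Reasoning
      r = base n (w (+ p))
      1≤q = proj₁ (windowIndex-bounds (opposite r))
      q≤N = proj₂ (windowIndex-bounds (opposite r))
      base-partner : base n (w (+ partner p)) ≡ opposite r
      base-partner = base-windowIndex (proj₁ (opposite-base-bounds (w (+ p)))) (proj₂ (opposite-base-bounds (w (+ p))))

    partner-decreasing : ∀ p → 1 ≤ p → suc p ≤ N → partner (suc p) < partner p
    partner-decreasing p 1≤p p<N =
      consecutive<⇒<-reflect (λ i → w (+ i)) window-increasing
        (proj₁ (windowIndex-bounds _)) (proj₂ (windowIndex-bounds _))
        (subst₂ ℤ._<_ (sym (w-partner (s≤s z≤n) p<N)) (sym (w-partner 1≤p (<⇒≤ p<N)))
                (reflect-< (window-increasing p 1≤p p<N)))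

    w-opposite : ∀ {p} → 1 ≤ p → p ≤ N → w (+ opposite p) ≡ reflect (w (+ p))
    w-opposite {p} 1≤p p≤N =
      subst (λ q → w (+ q) ≡ reflect (w (+ p)))
            (decreasing⇒reverse partner (λ q _ _ → windowIndex-bounds _) partner-decreasing p 1≤p p≤N)
            (w-partner 1≤p p≤N)

    antisymmetric⇒balanced : BalancedAbacus n w
    antisymmetric⇒balanced i 1≤i i≤n = base-sum , level≡
      where
      r = base n (w (+ i))
      base-sum : r ℕ.+ base n (w (+ opposite i)) ≡ suc N
      base-sum = begin
        r ℕ.+ base n (w (+ opposite i))        ≡⟨ cong (λ a → r ℕ.+ base n a) (w-opposite 1≤i (≤n⇒≤2n i≤n)) ⟩
        r ℕ.+ base n (reflect (w (+ i)))       ≡⟨ cong (r ℕ.+_) (proj₁ (base-level-reflect (w (+ i)))) ⟩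
        r ℕ.+ opposite r                       ≡⟨ m+[n∸m]≡n (m≤n⇒m≤1+n (base≤N (w (+ i)))) ⟩
        suc N                                  ∎
        where open ≡-Reasoning
      level≡ : level n (w (+ opposite i)) ≡ - level n (w (+ i))
      level≡ = trans (cong (level n) (w-opposite 1≤i (≤n⇒≤2n i≤n))) (proj₂ (base-level-reflect (w (+ i))))

lemma2p5 : (n : ℕ) .{{_ : NonZero n}} (w : ℤ → ℤ) →
    Bijective _≡_ _≡_ w →
    (∀ x → w (x + + twoN n) ≡ w x + + twoN n) →
    sumℤ (baseWindow n w) ≡ + (suc (twoN n) C 2) →
    (∀ i → 1 ≤ i → suc i ≤ twoN n → w (+ i) ℤ.< w (+ suc i)) →
    AntisymmetricLevelVector n w ⇔ BalancedAbacus n w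
lemma2p5 n w w-bijective w-periodic _ window-increasing =
  mk⇔ antisymmetric⇒balanced balanced⇒antisymmetric
  where open AffinePermutation n w w-bijective w-periodic window-increasing
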